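{- There is an absolute constant $c>0$ such that for all integers $n\ge 2$, $q\ge 1$, $m\ge 1$ and every antichain $A=\{\alpha_0,\ldots,\alpha_{n-1}\}\subset\{0,1\}^m$ of cardinality $n$ (with this fixed indexing), $$L(S_{q,A}) \le L(A) + c\, q n \log_2 n .$$
   Context: $L(F)$ denotes the minimal number of gates in a circuit over the basis $\{\vee,\wedge\}$ (binary disjunction and conjunction gates, inputs being the variables) computing the (possibly partially defined) boolean operator $F$; a circuit computes a partially defined operator if its outputs agree with $F$ on every input where $F$ is defined. Let $X=(x_0,\ldots,x_{n-1})$ with $x_i=(x_{i,0},\ldots,x_{i,q-1})^T$ be a $q\times n$ matrix of boolean variables, and $Y=(y_0,\ldots,y_{m-1})$ a vector of boolean variables. For a vector (or sequence of columns) $v=(v_0,\ldots,v_{n-1})$, $v\gg k$ denotes its cyclic shift by $k$ positions to the right, i.e. the sequence whose entry at position $(j+k)\bmod n$ is $v_j$. The monotone cyclic shift operator $S_{q,A}(X,Y)=(s_0,\ldots,s_{n-1})$ (with $nq+m$ inputs and $nq$ outputs) is the partially defined operator defined only for $Y\in A$, with $S_{q,A}(X,\alpha_k)=X\gg k$ for $k=0,\ldots,n-1$ and all $X\in\{0,1\}^{q\times n}$. For $v\in\{0,1\}^m$ let $Y^v=\bigwedge_{i: v_i=1} y_i$; $L(A)$ denotes the minimal number of gates of a circuit over $\{\vee,\wedge\}$ computing simultaneously all monomials $Y^{\alpha}$, $\alpha\in A$. -}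

module Defs where

open import Data.Nat using (ℕ; zero; suc; _+_)
open import Data.Fin using (Fin; toℕ)
open import Data.Bool using (Bool; true; false; _∧_; _∨_; if_then_else_)
open import Data.Vec using (Vec; []; _∷ʳ_; lookup)
open import Data.Vec.Functional using (foldr)
open import Data.Sum using (_⊎_; inj₁; inj₂)
open import Data.Product using (_×_; Σ; _,_)
open import Data.Unit using (⊤)
open import Relation.Binary.PropositionalEquality using (_≡_; _≢_)
open import Relation.Nullary using (¬_)

data Op : Set where
  OR AND : Op

applyOp : Op → Bool → Bool → Bool
applyOp OR  a b = a ∨ b
applyOp AND a b = a ∧ b

-- A node of a circuit with input variables indexed by I and s gates so far:
-- either an input variable or one of the previous gates.
Node : Set → ℕ → Set
Node I s = I ⊎ Fin s

data Circuit (I : Set) : ℕ → Set where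
  noGates : Circuit I 0
  addGate : ∀ {s} → Circuit I s → Op → Node I s → Node I s → Circuit I (suc s)

mutual
  gateValues : ∀ {I s} → Circuit I s → (I → Bool) → Vec Bool s
  gateValues noGates x = []
  gateValues (addGate c o a b) x =
    gateValues c x ∷ʳ applyOp o (nodeValue c x a) (nodeValue c x b)

  nodeValue : ∀ {I s} → Circuit I s → (I → Bool) → Node I s → Bool
  nodeValue c x (inj₁ i) = x i
  nodeValue c x (inj₂ j) = lookup (gateValues c x) j

record ComputesWith (I O : Set) (D : (I → Bool) → Set)
                    (F : (I → Bool) → O → Bool) (s : ℕ) : Set where
  field
    circuit : Circuit I s
    output  : O → Node I s
    correct : ∀ x → D x → ∀ o → nodeValue circuit x (output o) ≡ F x o

monomial : ∀ {m} → (Fin m → Bool) → (Fin m → Bool) → Bool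
monomial v y = foldr _∧_ true (λ i → if v i then y i else true)

_≤ᵇ_ : ∀ {m} → (Fin m → Bool) → (Fin m → Bool) → Set
u ≤ᵇ v = ∀ i → u i ≡ true → v i ≡ true

-- α : Fin n → {0,1}^m is an antichain of cardinality n (indexed α₀,…,α_{n-1}):
-- distinct indices give incomparable (hence distinct) vectors.
IsAntichain : ∀ {n m} → (Fin n → (Fin m → Bool)) → Set
IsAntichain {n} α = ∀ (i j : Fin n) → i ≢ j → ¬ (α i ≤ᵇ α j)

Everywhere : ∀ {I : Set} → (I → Bool) → Set
Everywhere _ = ⊤

-- L(A) ≤ s: operator computing all monomials Y^{α_k}, k < n (inputs Y, outputs Fin n)
MonomialsOp : ∀ {n m} → (Fin n → (Fin m → Bool)) → (Fin m → Bool) → Fin n → Bool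
MonomialsOp α y k = monomial (α k) y

-- Inputs of S_{q,A}: X entries (column j, row r) and the y variables.
SInput : ℕ → ℕ → ℕ → Set
SInput n q m = (Fin n × Fin q) ⊎ Fin m

-- Position j' equals (j + k) mod n  (for j, k, j' < n)
IsShiftPos : (n : ℕ) → Fin n → Fin n → Fin n → Set
IsShiftPos n k j j' = (toℕ j + toℕ k ≡ toℕ j') ⊎ (toℕ j + toℕ k ≡ toℕ j' + n)

-- S_{q,A} computed by a circuit with s gates: outputs are indexed by
-- (column, row) ∈ Fin n × Fin q; whenever Y = α_k, output column j' equals input
-- column j, where j' = (j + k) mod n  (i.e. S(X, α_k) = X ≫ k).
ComputesShift : (n q m : ℕ) → (Fin n → (Fin m → Bool)) → ℕ → Set
ComputesShift n q m α s =
  Σ (Circuit (SInput n q m) s) λ C →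
  Σ (Fin n × Fin q → Node (SInput n q m) s) λ out →
    ∀ (k : Fin n) (x : SInput n q m → Bool) →
      (∀ t → x (inj₂ t) ≡ α k t) →
      ∀ (j j' : Fin n) (r : Fin q) → IsShiftPos n k j j' →
        nodeValue C x (out (j' , r)) ≡ x (inj₁ (j , r))

module Submission where

-- On the domain Y = α_k the monomial Y^{α_{k'}} equals [k' = k], because A is
-- an antichain.  So a circuit for the monomials of A already supplies the
-- indicators E_{k'} of the shift amount k, and E₀ ∧ E₁ is the constant 0.
-- Writing k in binary we shift in ⌊log₂ n⌋ + 1 stages; the stage for weight u
-- and bit b computes B = ⋁_{b(k') = 1} E_{k'} and B̄ = ⋁_{b(k') = 0} E_{k'}
-- (at most 2n gates) and replaces each of the nq entries v_p by the
-- multiplexer (B ∧ v_{p-u}) ∨ (B̄ ∧ v_p) (3 gates each).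

open import Defs
open import Data.Nat using (ℕ; zero; suc; _+_; _*_; _≤_; _<_; z≤n; s≤s; z<s; _^_; ⌊_/2⌋)
open import Data.Nat.Properties
  using (≤-reflexive; ≤-trans; ≤-antisym; ≤-pred; <-trans; <-≤-trans; <⇒≱; ≮⇒≥; _<?_;
         m≤m+n; m≤n+m; m≤n⇒m≤1+n; m<m+n; +-comm; +-assoc; +-suc; +-identityʳ;
         +-monoʳ-≤; +-monoˡ-≤; *-zeroʳ; *-identityˡ; ^-monoʳ-≤; 1+n≢0; suc-injective)
open import Data.Nat.Logarithm using (⌊log₂_⌋; ⌊log₂⌋-mono-≤; ⌊log₂[2^n]⌋≡n)
open import Data.Nat.Tactic.RingSolver using (solve-∀)
open import Data.Fin using (Fin; zero; suc; toℕ; inject₁; fromℕ)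
open import Data.Fin.Properties using (_≟_; toℕ<n; toℕ-inject₁; toℕ-fromℕ; toℕ-injective)
open import Data.Bool using (Bool; true; false; _∧_; _∨_; not; if_then_else_)
open import Data.Bool.Properties using (∨-identityʳ; ∨-zeroʳ; ∧-identityʳ; ∧-zeroʳ)
open import Data.Bool.ListAction using (any)
open import Data.Vec using (Vec; []; _∷_; _∷ʳ_; lookup)
open import Data.List using (List; []; _∷_; length; allFin)
open import Data.List.Properties using (length-tabulate)
open import Data.List.Membership.Propositional using (_∈_)
open import Data.List.Membership.Propositional.Properties using (∈-allFin)
open import Data.List.Relation.Unary.Any using (here; there)
open import Data.Sum using (_⊎_; inj₁; inj₂)
open import Data.Product using (Σ; _×_; _,_; proj₁; proj₂)
open import Data.Unit using (tt)
open import Data.Empty using (⊥-elim)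
open import Relation.Nullary using (yes; no)
open import Relation.Nullary.Decidable using (isYes)
open import Relation.Binary.PropositionalEquality

-- (1) Extending circuits

lookup-∷ʳ-inject₁ : ∀ {A : Set} {s} (xs : Vec A s) (v : A) (j : Fin s) →
                    lookup (xs ∷ʳ v) (inject₁ j) ≡ lookup xs j
lookup-∷ʳ-inject₁ (x ∷ xs) v zero    = refl
lookup-∷ʳ-inject₁ (x ∷ xs) v (suc j) = lookup-∷ʳ-inject₁ xs v j

lookup-∷ʳ-last : ∀ {A : Set} {s} (xs : Vec A s) (v : A) → lookup (xs ∷ʳ v) (fromℕ s) ≡ v
lookup-∷ʳ-last []       v = refl
lookup-∷ʳ-last (x ∷ xs) v = lookup-∷ʳ-last xs v

-- Circuits are built relative to a family of input domains Dom k (in the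
-- theorem: Y = α_k); a signal may depend on the index k of the domain.
module Extension {I K : Set} (Dom : K → (I → Bool) → Set) where

  Signal : Set
  Signal = K → (I → Bool) → Bool

  Has : ∀ {s} → Circuit I s → Signal → Set
  Has {s} C F = Σ (Node I s) λ v → ∀ k x → Dom k x → nodeValue C x v ≡ F k x

  has-cong : ∀ {s} {C : Circuit I s} {F G : Signal} →
             (∀ k x → F k x ≡ G k x) → Has C F → Has C G
  has-cong F≗G (v , ok) = v , λ k x d → trans (ok k x d) (F≗G k x)

  _⊑_ : ∀ {s s'} → Circuit I s → Circuit I s' → Set
  _⊑_ {s} {s'} C C' = Σ (Node I s → Node I s') λ e → ∀ x v → nodeValue C' x (e v) ≡ nodeValue C x v

  ⊑-trans : ∀ {s₁ s₂ s₃} {C₁ : Circuit I s₁} {C₂ : Circuit I s₂} {C₃ : Circuit I s₃} →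
            C₁ ⊑ C₂ → C₂ ⊑ C₃ → C₁ ⊑ C₃
  ⊑-trans (e₁ , ok₁) (e₂ , ok₂) = (λ v → e₂ (e₁ v)) , λ x v → trans (ok₂ x (e₁ v)) (ok₁ x v)

  has-⊑ : ∀ {s s'} {C : Circuit I s} {C' : Circuit I s'} {F : Signal} → C ⊑ C' → Has C F → Has C' F
  has-⊑ (e , ok) (v , okv) = e v , λ k x d → trans (ok x v) (okv k x d)

  addGate-⊑ : ∀ {s} (C : Circuit I s) o a b → C ⊑ addGate C o a b
  addGate-⊑ C o a b = old , λ x → λ { (inj₁ i) → refl ; (inj₂ j) → lookup-∷ʳ-inject₁ (gateValues C x) _ j }
    where
    old : Node I _ → Node I (suc _)
    old (inj₁ i) = inj₁ i
    old (inj₂ j) = inj₂ (inject₁ j)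

  Goal : Set₁
  Goal = ∀ {s} → Circuit I s → Set

  Monotone : Goal → Set
  Monotone G = ∀ {s s'} {C : Circuit I s} {C' : Circuit I s'} → C ⊑ C' → G C → G C'

  record Built {s} (C : Circuit I s) (c : ℕ) (G : Goal) : Set where
    constructor built
    field
      {size}   : ℕ
      result   : Circuit I size
      bound    : size ≤ s + c
      extends  : C ⊑ result
      achieves : G result

  done : ∀ {s} {C : Circuit I s} {c} {G : Goal} → G C → Built C c G
  done {s} {C} {c} g = built C (m≤m+n s c) ((λ v → v) , λ x v → refl) g

  gate : ∀ {s} (C : Circuit I s) o {F G : Signal} → Has C F → Has C G →
         Built C 1 (λ C' → Has C' (λ k x → applyOp o (F k x) (G k x)))
  gate {s} C o (a , ok-a) (b , ok-b) =
    built (addGate C o a b) (≤-reflexive (+-comm 1 s)) (addGate-⊑ C o a b)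
      (inj₂ (fromℕ s) , λ k x d →
        trans (lookup-∷ʳ-last (gateValues C x) _) (cong₂ (applyOp o) (ok-a k x d) (ok-b k x d)))

  bind : ∀ {s} {C : Circuit I s} {c₁ c₂} {G₁ G₂ : Goal} → Built C c₁ G₁ →
         (∀ {s'} (C' : Circuit I s') → C ⊑ C' → G₁ C' → Built C' c₂ G₂) → Built C (c₁ + c₂) G₂
  bind {s} {c₁ = c₁} {c₂} (built C₁ b₁ C⊑C₁ g₁) next with next C₁ C⊑C₁ g₁
  ... | built C₂ b₂ C₁⊑C₂ g₂ =
    built C₂ (≤-trans b₂ (≤-trans (+-monoˡ-≤ c₂ b₁) (≤-reflexive (+-assoc s c₁ c₂))))
      (⊑-trans C⊑C₁ C₁⊑C₂) g₂

  weaken : ∀ {s} {C : Circuit I s} {c c'} {G : Goal} → c ≤ c' → Built C c G → Built C c' G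
  weaken {s} c≤c' (built C' b ext g) = built C' (≤-trans b (+-monoʳ-≤ s c≤c')) ext g

  Built-map : ∀ {s} {C : Circuit I s} {c} {G H : Goal} →
              (∀ {s'} {C' : Circuit I s'} → C ⊑ C' → G C' → H C') → Built C c G → Built C c H
  Built-map f (built C' b ext g) = built C' b ext (f ext g)

  forAll : ∀ N {c} {Inv : Goal} {G : Fin N → Goal} → Monotone Inv → (∀ i → Monotone (G i)) →
           (∀ i {s} (C : Circuit I s) → Inv C → Built C c (G i)) →
           ∀ {s} (C : Circuit I s) → Inv C → Built C (N * c) (λ C' → ∀ i → G i C')
  forAll zero    inv-mono G-mono task C inv = done (λ ())
  forAll (suc N) inv-mono G-mono task C inv =
    bind (task zero C inv) λ C₁ C⊑C₁ g₀ →
    Built-map (λ C₁⊑C₂ gs → λ { zero → G-mono zero C₁⊑C₂ g₀ ; (suc i) → gs i })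
      (forAll N inv-mono (λ i → G-mono (suc i)) (λ i → task (suc i)) C₁ (inv-mono C⊑C₁ inv))

  forAll² : ∀ N M {c} {Inv : Goal} {G : Fin N × Fin M → Goal} → Monotone Inv → (∀ p → Monotone (G p)) →
            (∀ p {s} (C : Circuit I s) → Inv C → Built C c (G p)) →
            ∀ {s} (C : Circuit I s) → Inv C → Built C (N * (M * c)) (λ C' → ∀ p → G p C')
  forAll² N M inv-mono G-mono task C inv =
    Built-map (λ _ gs (i , j) → gs i j)
      (forAll N inv-mono (λ i ext gs j → G-mono (i , j) ext (gs j))
        (λ i → forAll M inv-mono (λ j → G-mono (i , j)) (λ j → task (i , j))) C inv)

-- (2) Relabelling the inputs of a circuit along f : J → I

module Relabel {I J : Set} (f : J → I) where

  relabelNode : ∀ {s} → Node J s → Node I s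
  relabelNode (inj₁ j) = inj₁ (f j)
  relabelNode (inj₂ g) = inj₂ g

  relabel : ∀ {s} → Circuit J s → Circuit I s
  relabel noGates           = noGates
  relabel (addGate C o a b) = addGate (relabel C) o (relabelNode a) (relabelNode b)

  mutual
    relabel-gates : ∀ {s} (C : Circuit J s) x → gateValues (relabel C) x ≡ gateValues C (λ j → x (f j))
    relabel-gates noGates           x = refl
    relabel-gates (addGate C o a b) x =
      cong₂ _∷ʳ_ (relabel-gates C x) (cong₂ (applyOp o) (relabel-node C x a) (relabel-node C x b))

    relabel-node : ∀ {s} (C : Circuit J s) x v →
                   nodeValue (relabel C) x (relabelNode v) ≡ nodeValue C (λ j → x (f j)) v
    relabel-node C x (inj₁ j) = refl
    relabel-node C x (inj₂ g) = cong (λ vs → lookup vs g) (relabel-gates C x)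

-- (3) Cyclic rotation

rot : ∀ {n'} → Fin (suc n') → Fin (suc n')
rot {n'} zero = fromℕ n'
rot (suc i)   = inject₁ i

iter : ∀ {A : Set} → (A → A) → ℕ → A → A
iter f zero    x = x
iter f (suc t) x = iter f t (f x)

iter-+ : ∀ {A : Set} (f : A → A) t t' x → iter f (t + t') x ≡ iter f t' (iter f t x)
iter-+ f zero    t' x = refl
iter-+ f (suc t) t' x = iter-+ f t t' (f x)

-- j' is j shifted to the right by t positions (mod n), for t < 2n.
ShiftedBy : (n t : ℕ) → Fin n → Fin n → Set
ShiftedBy n t j j' = (toℕ j + t ≡ toℕ j') ⊎ (toℕ j + t ≡ toℕ j' + n)

peel : ∀ {j t y} → j + suc t ≡ suc y → j + t ≡ y
peel {j} {t} e = suc-injective (trans (sym (+-suc j t)) e)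

shiftedBy-rot : ∀ {n'} t (j j' : Fin (suc n')) →
                ShiftedBy (suc n') (suc t) j j' → ShiftedBy (suc n') t j (rot j')
shiftedBy-rot {n'} t j zero    (inj₁ e) = ⊥-elim (1+n≢0 (trans (sym (+-suc (toℕ j) t)) e))
shiftedBy-rot {n'} t j zero    (inj₂ e) = inj₁ (trans (peel e) (sym (toℕ-fromℕ n')))
shiftedBy-rot {n'} t j (suc i) (inj₁ e) = inj₁ (trans (peel e) (sym (toℕ-inject₁ i)))
shiftedBy-rot {n'} t j (suc i) (inj₂ e) = inj₂ (trans (peel e) (cong (_+ suc n') (sym (toℕ-inject₁ i))))

unshift : ∀ {n'} t (j j' : Fin (suc n')) → ShiftedBy (suc n') t j j' → iter rot t j' ≡ j
unshift zero j j' (inj₁ e) = toℕ-injective (sym (trans (sym (+-identityʳ (toℕ j))) e))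
unshift {n'} zero j j' (inj₂ e) = ⊥-elim (<⇒≱ (toℕ<n j) j≥n)
  where
  j≥n : suc n' ≤ toℕ j
  j≥n = ≤-trans (m≤n+m (suc n') (toℕ j')) (≤-reflexive (sym (trans (sym (+-identityʳ (toℕ j))) e)))
unshift (suc t) j j' sh = unshift t j (rot j') (shiftedBy-rot t j j' sh)

-- (4) Binary digits

lowBit : ℕ → Bool
lowBit zero          = false
lowBit (suc zero)    = true
lowBit (suc (suc g)) = lowBit g

binary-step : ∀ a u g → (if lowBit g then u + a else a) + (u + u) * ⌊ g /2⌋ ≡ a + u * g
binary-step a u zero          = no-digit a u
  where
  no-digit : ∀ A U → A + (U + U) * 0 ≡ A + U * 0
  no-digit = solve-∀
binary-step a u (suc zero)    = one-digit a u
  where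
  one-digit : ∀ A U → U + A + (U + U) * 0 ≡ A + U * 1
  one-digit = solve-∀
binary-step a u (suc (suc g)) = begin
  X + (u + u) * suc ⌊ g /2⌋        ≡⟨ regroup X u ⌊ g /2⌋ ⟩
  X + (u + u) * ⌊ g /2⌋ + (u + u)  ≡⟨ cong (_+ (u + u)) (binary-step a u g) ⟩
  a + u * g + (u + u)              ≡⟨ add-two a u g ⟩
  a + u * suc (suc g)              ∎
  where
  open ≡-Reasoning
  X = if lowBit g then u + a else a
  regroup : ∀ X U H → X + (U + U) * (1 + H) ≡ X + (U + U) * H + (U + U)
  regroup = solve-∀
  add-two : ∀ A U G → A + U * G + (U + U) ≡ A + U * (2 + G)
  add-two = solve-∀

below-one : ∀ a u g → g < 1 → a ≡ a + u * g
below-one a u zero    _          = sym (trans (cong (a +_) (*-zeroʳ u)) (+-identityʳ a))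
below-one a u (suc g) (s≤s ())

half-< : ∀ g N → g < 2 * N → ⌊ g /2⌋ < N
half-< g             zero    ()
half-< zero          (suc N) _          = z<s
half-< (suc zero)    (suc N) _          = z<s
half-< (suc (suc g)) (suc N) (s≤s g+2≤) =
  s≤s (half-< g N (≤-pred (subst (suc (suc g) ≤_) (+-suc N (N + 0)) g+2≤)))

-- (5) Monomials on an antichain

monomial-true : ∀ {m} (v y : Fin m → Bool) → v ≤ᵇ y → monomial v y ≡ true
monomial-true {zero}  v y v≤y = refl
monomial-true {suc m} v y v≤y with v zero in v₀
... | true rewrite v≤y zero v₀ = monomial-true (λ i → v (suc i)) (λ i → y (suc i)) (λ i → v≤y (suc i))
... | false = monomial-true (λ i → v (suc i)) (λ i → y (suc i)) (λ i → v≤y (suc i))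

monomial-true⁻¹ : ∀ {m} (v y : Fin m → Bool) → monomial v y ≡ true → v ≤ᵇ y
monomial-true⁻¹ {suc m} v y e zero v₀ with v zero
... | true = ∧-true-left e
  where ∧-true-left : ∀ {a b} → a ∧ b ≡ true → a ≡ true
        ∧-true-left {true} _ = refl
monomial-true⁻¹ {suc m} v y e (suc i) vᵢ =
  monomial-true⁻¹ (λ i → v (suc i)) (λ i → y (suc i)) (∧-true-right e) i vᵢ
  where ∧-true-right : ∀ {a b} → a ∧ b ≡ true → b ≡ true
        ∧-true-right {true} e = e

antichain-indicator : ∀ {n m} (α : Fin n → Fin m → Bool) → IsAntichain α →
                      ∀ k' k (y : Fin m → Bool) → (∀ t → y t ≡ α k t) → monomial (α k') y ≡ isYes (k' ≟ k)
antichain-indicator α antichain k' k y y≡αk with k' ≟ k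
... | yes refl = monomial-true (α k) y (λ i e → trans (y≡αk i) e)
... | no k'≢k with monomial (α k') y in e
...   | true  = ⊥-elim (antichain k' k k'≢k (λ i αk'ᵢ → trans (sym (y≡αk i)) (monomial-true⁻¹ (α k') y e i αk'ᵢ)))
...   | false = refl

-- (6) The barrel shifter

module BarrelShifter (n' q : ℕ) {I : Set} (cell : Fin (suc n') × Fin q → I)
                     (Dom : Fin (suc n') → (I → Bool) → Set) where

  n : ℕ
  n = suc n'

  open Extension Dom public

  indicator : Fin n → Signal
  indicator k' k x = isYes (k' ≟ k)

  Basis : Goal
  Basis C = (∀ k' → Has C (indicator k')) × Has C (λ _ _ → false)

  basis-mono : Monotone Basis
  basis-mono ext (ind , off) = (λ k' → has-⊑ ext (ind k')) , has-⊑ ext off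

  member : Fin n → List (Fin n) → Bool
  member k = any (λ k' → isYes (k' ≟ k))

  member-∈ : ∀ {k} L → k ∈ L → member k L ≡ true
  member-∈ {k} (k' ∷ L) (here refl) with k ≟ k
  ... | yes _  = refl
  ... | no k≢k = ⊥-elim (k≢k refl)
  member-∈ {k} (k' ∷ L) (there k∈L) = trans (cong (isYes (k' ≟ k) ∨_) (member-∈ L k∈L)) (∨-zeroʳ _)

  member-add-selected : ∀ (P : Fin n → Bool) k' L k → P k' ≡ true →
                        isYes (k' ≟ k) ∨ (P k ∧ member k L) ≡ P k ∧ member k (k' ∷ L)
  member-add-selected P k' L k Pk' with k' ≟ k
  ... | yes refl rewrite Pk' = refl
  ... | no _ = refl

  member-add-unselected : ∀ (P : Fin n → Bool) k' L k → P k' ≡ false →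
                          P k ∧ member k L ≡ P k ∧ member k (k' ∷ L)
  member-add-unselected P k' L k ¬Pk' with k' ≟ k
  ... | yes refl rewrite ¬Pk' = refl
  ... | no _ = refl

  orOf : (P : Fin n → Bool) (L : List (Fin n)) → ∀ {s} (C : Circuit I s) → Basis C →
         Built C (length L) (λ C' → Has C' (λ k _ → P k ∧ member k L))
  orOf P []       C (_ , off) = done (has-cong (λ k _ → sym (∧-zeroʳ (P k))) off)
  orOf P (k' ∷ L) C basis =
    weaken (≤-reflexive (+-comm (length L) 1))
      (bind (orOf P L C basis) λ C₁ C⊑C₁ h → add (P k') refl C₁ (basis-mono C⊑C₁ basis) h)
    where
    add : ∀ b → P k' ≡ b → ∀ {s} (C₁ : Circuit I s) → Basis C₁ → Has C₁ (λ k _ → P k ∧ member k L) →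
          Built C₁ 1 (λ C' → Has C' (λ k _ → P k ∧ member k (k' ∷ L)))
    add true  Pk' C₁ (ind , _) h =
      Built-map (λ _ → has-cong (λ k _ → member-add-selected P k' L k Pk')) (gate C₁ OR (ind k') h)
    add false ¬Pk' C₁ _ h = done (has-cong (λ k _ → member-add-unselected P k' L k ¬Pk') h)

  select : (P : Fin n → Bool) → ∀ {s} (C : Circuit I s) → Basis C →
           Built C n (λ C' → Has C' (λ k _ → P k))
  select P C basis =
    weaken (≤-reflexive (length-tabulate (λ i → i)))
      (Built-map (λ _ → has-cong (λ k _ → on-allFin k)) (orOf P (allFin n) C basis))
    where
    on-allFin : ∀ k → P k ∧ member k (allFin n) ≡ P k
    on-allFin k = trans (cong (P k ∧_) (member-∈ (allFin n) (∈-allFin k))) (∧-identityʳ (P k))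

  Position : Set
  Position = Fin n × Fin q

  -- Under shift amounts a, entry (j , r) holds the cell a(k) places to its left.
  entry : (Fin n → ℕ) → Position → Signal
  entry a (j , r) k x = x (cell (iter rot (a k) j , r))

  Positions : (Fin n → ℕ) → Goal
  Positions a C = ∀ p → Has C (entry a p)

  positions-mono : ∀ a → Monotone (Positions a)
  positions-mono a ext ps p = has-⊑ ext (ps p)

  positions-cong : ∀ {a a'} → (∀ k → a k ≡ a' k) → ∀ {s} {C : Circuit I s} → Positions a C → Positions a' C
  positions-cong a≗a' ps (j , r) =
    has-cong (λ k x → cong (λ t → x (cell (iter rot t j , r))) (a≗a' k)) (ps (j , r))

  advance : (Fin n → Bool) → ℕ → (Fin n → ℕ) → Fin n → ℕ
  advance b u a k = if b k then u + a k else a k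

  back : ℕ → Position → Position
  back u (j , r) = iter rot u j , r

  mux-correct : ∀ b u a p k x →
                (b k ∧ entry a (back u p) k x) ∨ (not (b k) ∧ entry a p k x) ≡ entry (advance b u a) p k x
  mux-correct b u a (j , r) k x with b k
  ... | true  = trans (∨-identityʳ _) (cong (λ i → x (cell (i , r))) (sym (iter-+ rot u (a k) j)))
  ... | false = refl

  MuxInputs : (Fin n → Bool) → (Fin n → ℕ) → Goal
  MuxInputs b a C = Has C (λ k _ → b k) × Has C (λ k _ → not (b k)) × Positions a C

  mux : ∀ b u a {s} (C : Circuit I s) → MuxInputs b a C →
        Built C (n * (q * 3)) (Positions (advance b u a))
  mux b u a = forAll² n q inputs-mono (λ _ ext → has-⊑ ext) gadget
    where
    inputs-mono : Monotone (MuxInputs b a)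
    inputs-mono ext (hb , hb̄ , ps) = has-⊑ ext hb , has-⊑ ext hb̄ , positions-mono a ext ps
    gadget : ∀ p {s} (C : Circuit I s) → MuxInputs b a C → Built C 3 (λ C' → Has C' (entry (advance b u a) p))
    gadget p C (hb , hb̄ , ps) =
      bind (gate C AND hb (ps (back u p))) λ C₁ C⊑C₁ shifted →
      bind (gate C₁ AND (has-⊑ C⊑C₁ hb̄) (has-⊑ C⊑C₁ (ps p))) λ C₂ C₁⊑C₂ kept →
      Built-map (λ _ → has-cong (mux-correct b u a p)) (gate C₂ OR (has-⊑ C₁⊑C₂ shifted) kept)

  stageCost : ℕ
  stageCost = n + (n + n * (q * 3))

  stage : ∀ b u a {s} (C : Circuit I s) → Basis C → Positions a C →
          Built C stageCost (λ C' → Basis C' × Positions (advance b u a) C')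
  stage b u a C basis ps =
    bind (select b C basis) λ C₁ C⊑C₁ hb →
    bind (select (λ k → not (b k)) C₁ (basis-mono C⊑C₁ basis)) λ C₂ C₁⊑C₂ hb̄ →
    let C⊑C₂ = ⊑-trans C⊑C₁ C₁⊑C₂ in
    Built-map (λ C₂⊑C₃ ps' → basis-mono (⊑-trans C⊑C₂ C₂⊑C₃) basis , ps')
      (mux b u a C₂ (has-⊑ C₁⊑C₂ hb , hb̄ , positions-mono a C⊑C₂ ps))

  barrel : ∀ d (g : Fin n → ℕ) → (∀ k → g k < 2 ^ d) → ∀ u a {s} (C : Circuit I s) →
           Basis C → Positions a C → Built C (d * stageCost) (Positions (λ k → a k + u * g k))
  barrel zero    g g< u a C basis ps = done (positions-cong (λ k → below-one (a k) u (g k) (g< k)) ps)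
  barrel (suc d) g g< u a C basis ps =
    bind (stage (λ k → lowBit (g k)) u a C basis ps) λ { C₁ _ (basis₁ , ps₁) →
    Built-map (λ _ → positions-cong (λ k → binary-step (a k) u (g k)))
      (barrel d (λ k → ⌊ g k /2⌋) (λ k → half-< (g k) (2 ^ d) (g< k)) (u + u)
        (advance (λ k → lowBit (g k)) u a) C₁ basis₁ ps₁) }

-- (7) Number of stages and the gate count

dyadic-interval : ∀ N → 1 ≤ N → Σ ℕ λ D → 2 ^ D ≤ N × N < 2 ^ suc D
dyadic-interval (suc zero)     _ = 0 , s≤s z≤n , s≤s (s≤s z≤n)
dyadic-interval (suc (suc N')) _ with dyadic-interval (suc N') (s≤s z≤n)
... | D , 2^D≤ , <2^1+D with suc (suc N') <? 2 ^ suc D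
...   | yes N<2^1+D = D , m≤n⇒m≤1+n 2^D≤ , N<2^1+D
...   | no  N≮2^1+D = suc D , ≤-reflexive (sym N≡2^1+D) , N<2^2+D
  where
  N≡2^1+D : suc (suc N') ≡ 2 ^ suc D
  N≡2^1+D = ≤-antisym <2^1+D (≮⇒≥ N≮2^1+D)
  N<2^2+D : suc (suc N') < 2 ^ suc (suc D)
  N<2^2+D = subst (_< 2 ^ suc (suc D)) (sym N≡2^1+D)
              (m<m+n (2 ^ suc D) (subst (0 <_) (trans N≡2^1+D (sym (+-identityʳ _))) z<s))

<2^suc⌊log₂⌋ : ∀ N → 1 ≤ N → N < 2 ^ suc ⌊log₂ N ⌋
<2^suc⌊log₂⌋ N 1≤N with dyadic-interval N 1≤N
... | D , 2^D≤N , N<2^1+D = <-≤-trans N<2^1+D (^-monoʳ-≤ 2 (s≤s D≤⌊log₂N⌋))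
  where
  D≤⌊log₂N⌋ : D ≤ ⌊log₂ N ⌋
  D≤⌊log₂N⌋ = subst (_≤ ⌊log₂ N ⌋) (⌊log₂[2^n]⌋≡n D) (⌊log₂⌋-mono-≤ 2^D≤N)

1≤⌊log₂⌋ : ∀ N → 2 ≤ N → 1 ≤ ⌊log₂ N ⌋
1≤⌊log₂⌋ N 2≤N = ⌊log₂⌋-mono-≤ 2≤N

-- One gate for the constant 0 and L + 1 stages of 2n + 3nq gates fit in 11·q·n·L.
gate-count : ∀ n q L → 1 ≤ n → 1 ≤ q → 1 ≤ L → 1 + suc L * (n + (n + n * (q * 3))) ≤ 11 * q * n * L
gate-count (suc a) (suc b) (suc c) _ _ _ =
  subst (cost ≤_) (exact a b c) (m≤m+n cost (a + suc a * (5 * b + 6 * c + 8 * b * c)))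
  where
  cost = 1 + suc (suc c) * (suc a + (suc a + suc a * (suc b * 3)))
  exact : ∀ a b c → 1 + (2 + c) * ((1 + a) + ((1 + a) + (1 + a) * ((1 + b) * 3)))
                      + (a + (1 + a) * (5 * b + 6 * c + 8 * b * c))
                    ≡ 11 * (1 + b) * (1 + a) * (1 + c)
  exact = solve-∀

module MonotoneShift (n'' q' m : ℕ) (α : Fin (suc (suc n'')) → Fin m → Bool)
                     (antichain : IsAntichain α) where

  n q : ℕ
  n = suc (suc n'')
  q = suc q'

  -- S_{q,A} is defined on the inputs whose y-part is some α_k.
  OnDomain : Fin n → (SInput n q m → Bool) → Set
  OnDomain k x = ∀ t → x (inj₂ t) ≡ α k t

  open BarrelShifter (suc n'') q inj₁ OnDomain hiding (n)
  open Relabel {SInput n q m} inj₂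

  -- The monomial circuit, read on the y-inputs, provides the indicators; one more
  -- gate E₀ ∧ E₁ gives the constant 0, and the x-inputs are the unshifted array.
  start : ∀ {s} (cw : ComputesWith (Fin m) (Fin n) Everywhere (MonomialsOp α) s) →
          Built (relabel (ComputesWith.circuit cw)) 1 (λ C → Basis C × Positions (λ _ → 0) C)
  start cw =
    Built-map (λ ext off → ((λ k' → has-⊑ ext (indicators k')) , has-cong disjoint off) ,
                          positions-mono (λ _ → 0) ext inputs)
      (gate C₀ AND (indicators zero) (indicators (suc zero)))
    where
    open ComputesWith cw
    C₀ = relabel circuit
    indicators : ∀ k' → Has C₀ (indicator k')
    indicators k' = relabelNode (output k') , λ k x onDom →
      trans (relabel-node circuit x (output k'))
            (trans (correct _ tt k') (antichain-indicator α antichain k' k _ onDom))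
    disjoint : ∀ k x → isYes (zero ≟ k) ∧ isYes (suc zero ≟ k) ≡ false
    disjoint zero    x = refl
    disjoint (suc k) x = refl
    inputs : Positions (λ _ → 0) C₀
    inputs p = inj₁ (inj₁ p) , λ k x onDom → refl

  computes-shift : ∀ {t} (C : Circuit (SInput n q m) t) → Positions (λ k → 0 + 1 * toℕ k) C →
                   ComputesShift n q m α t
  computes-shift C ps = C , (λ p → proj₁ (ps p)) , λ k x onDom j j' r shifted →
    trans (proj₂ (ps (j' , r)) k x onDom)
          (cong (λ i → x (inj₁ (i , r)))
                (trans (cong (λ t → iter rot t j') (*-identityˡ (toℕ k))) (unshift (toℕ k) j j' shifted)))

  shift-circuit : ∀ L → n < 2 ^ suc L → 1 ≤ L → ∀ s →
                  ComputesWith (Fin m) (Fin n) Everywhere (MonomialsOp α) s →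
                  Σ ℕ λ t → t ≤ s + 11 * q * n * L × ComputesShift n q m α t
  shift-circuit L n<2^1+L 1≤L s cw =
    finish (bind (start cw) λ { C _ (basis , ps) → barrel (suc L) toℕ digits 1 (λ _ → 0) C basis ps })
    where
    digits : ∀ k → toℕ k < 2 ^ suc L
    digits k = <-trans (toℕ<n k) n<2^1+L
    finish : Built (relabel (ComputesWith.circuit cw)) (1 + suc L * stageCost)
                   (Positions (λ k → 0 + 1 * toℕ k)) →
             Σ ℕ λ t → t ≤ s + 11 * q * n * L × ComputesShift n q m α t
    finish (built C size≤ _ ps) =
      _ , ≤-trans size≤ (+-monoʳ-≤ s (gate-count n q L (s≤s z≤n) (s≤s z≤n) 1≤L)) , computes-shift C ps

theorem1 : Σ ℕ λ c →
    ∀ (n q m : ℕ) → 2 ≤ n → 1 ≤ q → 1 ≤ m →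
    (α : Fin n → (Fin m → Bool)) → IsAntichain α →
    ∀ (s : ℕ) → ComputesWith (Fin m) (Fin n) Everywhere (MonomialsOp α) s →
    Σ ℕ λ t → t ≤ s + c * q * n * ⌊log₂ n ⌋ × ComputesShift n q m α t
theorem1 = 11 , λ { .(suc (suc n'')) .(suc q') m (s≤s (s≤s {n = n''} _)) (s≤s {n = q'} _) _ α antichain →
                    MonotoneShift.shift-circuit n'' q' m α antichain ⌊log₂ suc (suc n'') ⌋
                      (<2^suc⌊log₂⌋ (suc (suc n'')) (s≤s z≤n)) (1≤⌊log₂⌋ (suc (suc n'')) (s≤s (s≤s z≤n))) }
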